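{- Let $J_i$ be the graph with vertex set $\{x_i,x'_i,s,a,b,b',a',t\}$ and edge set $\{x_is,\ t x'_i,\ sa,\ ab,\ bb',\ b'a',\ a't,\ st,\ tb,\ ba',\ a'a,\ ab',\ b's\}$ (so $\{a,b,a',b'\}$ induces a $K_4$). Let $H$ be any graph containing $J_i$ as a subgraph in which the vertices $s,a,b,b',a',t$ have no neighbours other than their neighbours in $J_i$, and let $S$ be a minimum vertex cover of $H$. Write $S_i=S\cap\{s,a,b,b',a',t\}$. If $S$ contains at least one of $x_i,x'_i$, then $|S_i|=4$; otherwise $|S_i|=5$.
   Context: A vertex cover of a graph is a vertex set meeting every edge; a minimum vertex cover is one of smallest size. -}

module Defs where

open import Data.Nat using (ℕ; _≤_)
open import Data.Fin using (Fin)
open import Data.Fin.Subset using (Subset; _∈_; _∩_; _∪_; ⁅_⁆; ∣_∣)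
open import Data.Product using (Σ; _×_)
open import Data.Sum using (_⊎_)
open import Data.Empty using (⊥)
open import Data.Unit using (⊤)
open import Relation.Binary.PropositionalEquality using (_≡_)
open import Relation.Nullary using (¬_)
open import Function.Definitions using (Injective)

record Graph (n : ℕ) : Set₁ where
  field
    Adj    : Fin n → Fin n → Set
    sym    : ∀ {u v} → Adj u v → Adj v u
    irrefl : ∀ {v} → ¬ Adj v v
open Graph public

IsVertexCover : ∀ {n} → Graph n → Subset n → Set
IsVertexCover G S = ∀ u v → Adj G u v → u ∈ S ⊎ v ∈ S

IsMinVertexCover : ∀ {n} → Graph n → Subset n → Set
IsMinVertexCover G S =
  IsVertexCover G S × (∀ T → IsVertexCover G T → ∣ S ∣ ≤ ∣ T ∣)

data JV : Set where
  vx vx' vs va vb vb' va' vt : JV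

data JEdge : JV → JV → Set where
  e-xs   : JEdge vx vs
  e-tx'  : JEdge vt vx'
  e-sa   : JEdge vs va
  e-ab   : JEdge va vb
  e-bb'  : JEdge vb vb'
  e-b'a' : JEdge vb' va'
  e-a't  : JEdge va' vt
  e-st   : JEdge vs vt
  e-tb   : JEdge vt vb
  e-ba'  : JEdge vb va'
  e-a'a  : JEdge va' va
  e-ab'  : JEdge va vb'
  e-b's  : JEdge vb' vs

JAdj : JV → JV → Set
JAdj u v = JEdge u v ⊎ JEdge v u

Inner : JV → Set
Inner vx  = ⊥
Inner vx' = ⊥
Inner _   = ⊤

record ContainsJ {n : ℕ} (H : Graph n) (f : JV → Fin n) : Set where
  field
    injective : Injective _≡_ _≡_ f
    edges     : ∀ {u v} → JEdge u v → Adj H (f u) (f v)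
    closed    : ∀ v → Inner v → ∀ w → Adj H (f v) w →
                Σ JV (λ u → JAdj v u × f u ≡ w)

innerPart : ∀ {n} → (JV → Fin n) → Subset n → Subset n
innerPart f S =
  S ∩ (⁅ f vs ⁆ ∪ (⁅ f va ⁆ ∪ (⁅ f vb ⁆ ∪ (⁅ f vb' ⁆ ∪ (⁅ f va' ⁆ ∪ ⁅ f vt ⁆)))))

module Submission where

-- Put U = {s, a, b, b', a', t} (the image of the inner
-- vertices) and read a minimum vertex cover S back on J as the labelling
-- w ↦ [f w ∈ S], which covers every edge of J.
--   Lower bound: the K4 on {a, b, a', b'} forces three labels and the edge st
--   a fourth; if neither x nor x' is chosen, the edges xs and tx' force both
--   s and t, giving five.  Since f is injective, |S ∩ U| equals the number of
--   labelled inner vertices.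
--   Upper bound (exchange): for any set R, if R ∪ (S ─ U) is again a vertex
--   cover then minimality gives |S ∩ U| ≤ |R|.  Three explicit labellings of J
--   (using x, using x', using neither) with 4, 4, 5 inner vertices supply R;
--   they cover H because inner vertices only have neighbours inside J.

open import Defs hiding (sym)
open import Data.Nat using (ℕ; suc; _+_; _≤_; z≤n; s≤s)
open import Data.Nat.Properties using (+-suc; ≤-refl; ≤-trans; ≤-reflexive; n≤1+n; m≤n+m; m≤m+n; +-monoʳ-≤; +-mono-≤; +-cancelʳ-≤; ≤-antisym; module ≤-Reasoning)
open import Data.Bool using (Bool; true; false; _∨_; T)
open import Data.Bool.Properties using (T-∨; T-≡)
open import Data.Unit using (tt)
open import Data.Empty using (⊥-elim)
open import Data.Fin using (Fin; zero; suc)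
open import Data.Fin.Subset using (Subset; _∈_; _∉_; _∩_; _∪_; _─_; ⁅_⁆; ∣_∣) renaming (⊥ to ∅)
open import Data.Fin.Subset.Properties using (_∈?_; ∉⊥; x∈⁅x⁆; x∈⁅y⁆⇒x≡y; x∈p∪q⁺; x∈p∪q⁻; x∈p∧x∉q⇒x∈p─q; ∣⁅x⁆∣≡1; ∣⊥∣≡0; ∪-identityˡ; ∪-identityʳ; ∩-zeroʳ)
open import Data.Vec using (_∷_; []; lookup)
import Data.Vec.Base as Vec
open import Data.Vec.Properties using ([]=⇒lookup; lookup⇒[]=)
open import Data.List using (List; length; filter; map) renaming ([] to []ₗ; _∷_ to _∷ₗ_)
open import Data.Nat.ListAction using (sum)
open import Data.List.Relation.Unary.Any using (here; there)
open import Data.List.Relation.Unary.All using (All) renaming ([] to []ᵃ; _∷_ to _∷ᵃ_)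
import Data.List.Relation.Unary.All as All
open import Data.List.Relation.Unary.AllPairs using () renaming ([] to []ᵖ; _∷_ to _∷ᵖ_)
open import Data.List.Relation.Unary.Unique.Propositional using (Unique)
open import Data.List.Membership.Propositional using () renaming (_∈_ to _∈ₗ_)
open import Data.List.Membership.Propositional.Properties using (∈-filter⁺)
open import Data.Sum using (_⊎_; inj₁; inj₂) renaming (map to map⊎; swap to swap⊎)
open import Data.Product using (_×_; _,_; Σ; proj₁)
open import Function using (_∘_)
open import Function.Bundles using (Equivalence)
open import Function.Definitions using (Injective)
open import Relation.Nullary using (¬_; yes; no)
open import Relation.Nullary.Decidable using (T?)
open import Relation.Binary.PropositionalEquality using (_≡_; refl; sym; trans; cong; subst)

indicator : Bool → ℕ
indicator true  = 1
indicator false = 0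

∣p∪q∣≤∣p∣+∣q∣ : ∀ {n} (p q : Subset n) → ∣ p ∪ q ∣ ≤ ∣ p ∣ + ∣ q ∣
∣p∪q∣≤∣p∣+∣q∣ []          []          = z≤n
∣p∪q∣≤∣p∣+∣q∣ (true ∷ p)  (true ∷ q)  =
  s≤s (≤-trans (∣p∪q∣≤∣p∣+∣q∣ p q) (+-monoʳ-≤ ∣ p ∣ (n≤1+n ∣ q ∣)))
∣p∪q∣≤∣p∣+∣q∣ (true ∷ p)  (false ∷ q) = s≤s (∣p∪q∣≤∣p∣+∣q∣ p q)
∣p∪q∣≤∣p∣+∣q∣ (false ∷ p) (true ∷ q)  =
  ≤-trans (s≤s (∣p∪q∣≤∣p∣+∣q∣ p q)) (≤-reflexive (sym (+-suc ∣ p ∣ ∣ q ∣)))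
∣p∪q∣≤∣p∣+∣q∣ (false ∷ p) (false ∷ q) = ∣p∪q∣≤∣p∣+∣q∣ p q

∣p∣≡∣p∩q∣+∣p─q∣ : ∀ {n} (p q : Subset n) → ∣ p ∣ ≡ ∣ p ∩ q ∣ + ∣ p ─ q ∣
∣p∣≡∣p∩q∣+∣p─q∣ []          []          = refl
∣p∣≡∣p∩q∣+∣p─q∣ (true ∷ p)  (true ∷ q)  = cong suc (∣p∣≡∣p∩q∣+∣p─q∣ p q)
∣p∣≡∣p∩q∣+∣p─q∣ (true ∷ p)  (false ∷ q) =
  trans (cong suc (∣p∣≡∣p∩q∣+∣p─q∣ p q)) (sym (+-suc ∣ p ∩ q ∣ ∣ p ─ q ∣))
∣p∣≡∣p∩q∣+∣p─q∣ (false ∷ p) (true ∷ q)  = ∣p∣≡∣p∩q∣+∣p─q∣ p q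
∣p∣≡∣p∩q∣+∣p─q∣ (false ∷ p) (false ∷ q) = ∣p∣≡∣p∩q∣+∣p─q∣ p q

∣p∩⁅i⁆∪q∣ : ∀ {n} (p q : Subset n) (i : Fin n) → i ∉ q →
  ∣ p ∩ (⁅ i ⁆ ∪ q) ∣ ≡ indicator (lookup p i) + ∣ p ∩ q ∣
∣p∩⁅i⁆∪q∣ (_ ∷ p)     (true ∷ q)  zero    i∉q = ⊥-elim (i∉q Vec.here)
∣p∩⁅i⁆∪q∣ (true ∷ p)  (false ∷ q) zero    _   = cong (suc ∘ ∣_∣ ∘ (p ∩_)) (∪-identityˡ q)
∣p∩⁅i⁆∪q∣ (false ∷ p) (false ∷ q) zero    _   = cong (∣_∣ ∘ (p ∩_)) (∪-identityˡ q)
∣p∩⁅i⁆∪q∣ (true ∷ p)  (true ∷ q)  (suc i) i∉q =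
  trans (cong suc (∣p∩⁅i⁆∪q∣ p q i (i∉q ∘ Vec.there))) (sym (+-suc _ _))
∣p∩⁅i⁆∪q∣ (true ∷ p)  (false ∷ q) (suc i) i∉q = ∣p∩⁅i⁆∪q∣ p q i (i∉q ∘ Vec.there)
∣p∩⁅i⁆∪q∣ (false ∷ p) (_ ∷ q)     (suc i) i∉q = ∣p∩⁅i⁆∪q∣ p q i (i∉q ∘ Vec.there)

image : ∀ {n} {A : Set} → (A → Fin n) → List A → Subset n
image f []ₗ        = ∅
image f (w ∷ₗ ws) = ⁅ f w ⁆ ∪ image f ws

module _ {n : ℕ} {A : Set} (f : A → Fin n) where

  ∈-image⁺ : ∀ {w ws} → w ∈ₗ ws → f w ∈ image f ws
  ∈-image⁺ {ws = w ∷ₗ _} (here refl) = x∈p∪q⁺ (inj₁ (x∈⁅x⁆ (f w)))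
  ∈-image⁺ (there w∈ws)              = x∈p∪q⁺ (inj₂ (∈-image⁺ w∈ws))

  ∈-image⁻ : ∀ {i} ws → i ∈ image f ws → Σ A (λ w → w ∈ₗ ws × f w ≡ i)
  ∈-image⁻ []ₗ        i∈ = ⊥-elim (∉⊥ i∈)
  ∈-image⁻ (w ∷ₗ ws) i∈ with x∈p∪q⁻ ⁅ f w ⁆ (image f ws) i∈
  ... | inj₁ i∈⁅fw⁆ = w , here refl , sym (x∈⁅y⁆⇒x≡y (f w) i∈⁅fw⁆)
  ... | inj₂ i∈rest with ∈-image⁻ ws i∈rest
  ...   | v , v∈ws , fv≡i = v , there v∈ws , fv≡i

  ∣image∣≤length : ∀ ws → ∣ image f ws ∣ ≤ length ws
  ∣image∣≤length []ₗ        = ≤-reflexive (∣⊥∣≡0 n)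
  ∣image∣≤length (w ∷ₗ ws) = ≤-trans (∣p∪q∣≤∣p∣+∣q∣ ⁅ f w ⁆ (image f ws))
    (+-mono-≤ (≤-reflexive (∣⁅x⁆∣≡1 (f w))) (∣image∣≤length ws))

  ∣p∩image∣ : Injective _≡_ _≡_ f → ∀ {ws} → Unique ws → (p : Subset n) →
    ∣ p ∩ image f ws ∣ ≡ sum (map (λ w → indicator (lookup p (f w))) ws)
  ∣p∩image∣ inj []ᵖ p = trans (cong ∣_∣ (∩-zeroʳ p)) (∣⊥∣≡0 n)
  ∣p∩image∣ inj {w ∷ₗ ws} (w∉ws ∷ᵖ unique) p =
    trans (∣p∩⁅i⁆∪q∣ p (image f ws) (f w) fw∉)
          (cong (indicator (lookup p (f w)) +_) (∣p∩image∣ inj unique p))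
    where
    fw∉ : f w ∉ image f ws
    fw∉ fw∈ with ∈-image⁻ ws fw∈
    ... | v , v∈ws , fv≡fw = All.lookup w∉ws v∈ws (sym (inj fv≡fw))

exchange : ∀ {n} (G : Graph n) {S : Subset n} → IsMinVertexCover G S →
  (U R : Subset n) → IsVertexCover G (R ∪ (S ─ U)) → ∣ S ∩ U ∣ ≤ ∣ R ∣
exchange G {S} (_ , minimal) U R cover = +-cancelʳ-≤ (∣ S ─ U ∣) (∣ S ∩ U ∣) (∣ R ∣) (begin
  ∣ S ∩ U ∣ + ∣ S ─ U ∣  ≡⟨ sym (∣p∣≡∣p∩q∣+∣p─q∣ S U) ⟩
  ∣ S ∣                  ≤⟨ minimal (R ∪ (S ─ U)) cover ⟩
  ∣ R ∪ (S ─ U) ∣        ≤⟨ ∣p∪q∣≤∣p∣+∣q∣ R (S ─ U) ⟩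
  ∣ R ∣ + ∣ S ─ U ∣      ∎)
  where open ≤-Reasoning

innerL : List JV
innerL = vs ∷ₗ va ∷ₗ vb ∷ₗ vb' ∷ₗ va' ∷ₗ vt ∷ₗ []ₗ

innerL-unique : Unique innerL
innerL-unique =
  ((λ ()) ∷ᵃ (λ ()) ∷ᵃ (λ ()) ∷ᵃ (λ ()) ∷ᵃ (λ ()) ∷ᵃ []ᵃ) ∷ᵖ
  ((λ ()) ∷ᵃ (λ ()) ∷ᵃ (λ ()) ∷ᵃ (λ ()) ∷ᵃ []ᵃ) ∷ᵖ
  ((λ ()) ∷ᵃ (λ ()) ∷ᵃ (λ ()) ∷ᵃ []ᵃ) ∷ᵖ
  ((λ ()) ∷ᵃ (λ ()) ∷ᵃ []ᵃ) ∷ᵖ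
  ((λ ()) ∷ᵃ []ᵃ) ∷ᵖ
  ([]ᵃ ∷ᵖ []ᵖ)

innerL-inner : All Inner innerL
innerL-inner = tt ∷ᵃ tt ∷ᵃ tt ∷ᵃ tt ∷ᵃ tt ∷ᵃ tt ∷ᵃ []ᵃ

listed-or-outer : ∀ w → w ∈ₗ innerL ⊎ (w ≡ vx ⊎ w ≡ vx')
listed-or-outer vx  = inj₂ (inj₁ refl)
listed-or-outer vx' = inj₂ (inj₂ refl)
listed-or-outer vs  = inj₁ (here refl)
listed-or-outer va  = inj₁ (there (here refl))
listed-or-outer vb  = inj₁ (there (there (here refl)))
listed-or-outer vb' = inj₁ (there (there (there (here refl))))
listed-or-outer va' = inj₁ (there (there (there (there (here refl)))))
listed-or-outer vt  = inj₁ (there (there (there (there (there (here refl))))))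

CoversJ : (JV → Bool) → Set
CoversJ g = ∀ {u v} → JEdge u v → T (g u ∨ g v)

innerCount : (JV → Bool) → ℕ
innerCount g = sum (map (indicator ∘ g) innerL)

-- Any cover of K4 uses at least three of its four vertices.
-- The hypotheses are the six edges ab, ac, da, bc, bd, cd.
k4-cover : ∀ a b c d m → T (a ∨ b) → T (a ∨ c) → T (d ∨ a) → T (b ∨ c) → T (b ∨ d) → T (c ∨ d) →
  3 + m ≤ indicator a + (indicator b + (indicator c + (indicator d + m)))
k4-cover true  true  true  d     m _  _  _  _  _  _  = s≤s (s≤s (s≤s (m≤n+m m (indicator d))))
k4-cover true  true  false true  m _  _  _  _  _  _  = ≤-refl
k4-cover true  false true  true  m _  _  _  _  _  _  = ≤-refl
k4-cover false true  true  true  m _  _  _  _  _  _  = ≤-refl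
k4-cover true  true  false false m _  _  _  _  _  ()
k4-cover true  false true  false m _  _  _  _  () _
k4-cover true  false false _     m _  _  _  () _  _
k4-cover false true  true  false m _  _  () _  _  _
k4-cover false true  false _     m _  () _  _  _  _
k4-cover false false _     _     m () _  _  _  _  _

k4-bound : ∀ g → CoversJ g → ∀ m →
  3 + m ≤ indicator (g va) + (indicator (g vb) + (indicator (g vb') + (indicator (g va') + m)))
k4-bound g cover m = k4-cover (g va) (g vb) (g vb') (g va') m
  (cover e-ab) (cover e-ab') (cover e-a'a) (cover e-bb') (cover e-ba') (cover e-b'a')

-- A cover of J labels at least four inner vertices: three in the K4, one on st.
four-inner : ∀ g → CoversJ g → 4 ≤ innerCount g
four-inner g cover with g vs | g vt | cover e-st
... | true  | t     | _ = s≤s (≤-trans (m≤m+n 3 (indicator t + 0)) (k4-bound g cover (indicator t + 0)))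
... | false | true  | _ = k4-bound g cover 1
... | false | false | ()

resolveˡ : ∀ {x y} → T (x ∨ y) → ¬ T x → T y
resolveˡ {true}  _   ¬x = ⊥-elim (¬x tt)
resolveˡ {false} x∨y _  = x∨y

resolveʳ : ∀ {x y} → T (x ∨ y) → ¬ T y → T x
resolveʳ {true}  _   _  = tt
resolveʳ {false} x∨y ¬y = ⊥-elim (¬y x∨y)

-- If neither x nor x' is labelled, the edges xs and tx' force both s and t.
five-inner : ∀ g → CoversJ g → ¬ T (g vx) → ¬ T (g vx') → 5 ≤ innerCount g
five-inner g cover ¬x ¬x'
  with g vs | g vt | resolveˡ {g vx} {g vs} (cover e-xs) ¬x | resolveʳ {g vt} {g vx'} (cover e-tx') ¬x'
... | true  | true  | _  | _  = s≤s (k4-bound g cover 1)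
... | false | _     | () | _
... | true  | false | _  | ()

cover-x cover-x' cover-none : JV → Bool
cover-x vx  = true
cover-x vt  = true
cover-x va  = true
cover-x vb' = true
cover-x va' = true
cover-x _   = false

cover-x' vx' = true
cover-x' vs  = true
cover-x' vb  = true
cover-x' vb' = true
cover-x' va' = true
cover-x' _   = false

cover-none vs  = true
cover-none vt  = true
cover-none va  = true
cover-none vb  = true
cover-none va' = true
cover-none _   = false

cover-x-covers : CoversJ cover-x
cover-x-covers = λ { e-xs → tt ; e-tx' → tt ; e-sa → tt ; e-ab → tt ; e-bb' → tt ; e-b'a' → tt ;
  e-a't → tt ; e-st → tt ; e-tb → tt ; e-ba' → tt ; e-a'a → tt ; e-ab' → tt ; e-b's → tt }

cover-x'-covers : CoversJ cover-x'
cover-x'-covers = λ { e-xs → tt ; e-tx' → tt ; e-sa → tt ; e-ab → tt ; e-bb' → tt ; e-b'a' → tt ;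
  e-a't → tt ; e-st → tt ; e-tb → tt ; e-ba' → tt ; e-a'a → tt ; e-ab' → tt ; e-b's → tt }

cover-none-covers : CoversJ cover-none
cover-none-covers = λ { e-xs → tt ; e-tx' → tt ; e-sa → tt ; e-ab → tt ; e-bb' → tt ; e-b'a' → tt ;
  e-a't → tt ; e-st → tt ; e-tb → tt ; e-ba' → tt ; e-a'a → tt ; e-ab' → tt ; e-b's → tt }

∈⇒T : ∀ {n} {p : Subset n} {i} → i ∈ p → T (lookup p i)
∈⇒T i∈p rewrite []=⇒lookup i∈p = tt

T⇒∈ : ∀ {n} (p : Subset n) i → T (lookup p i) → i ∈ p
T⇒∈ p i t = lookup⇒[]= i p (Equivalence.to T-≡ t)

module Gadget {n : ℕ} (H : Graph n) (f : JV → Fin n) (J : ContainsJ H f)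
              (S : Subset n) (minimum : IsMinVertexCover H S) where

  U : Subset n
  U = image f innerL

  innerPart≡S∩U : innerPart f S ≡ S ∩ U
  innerPart≡S∩U = cong (λ q → S ∩ (⁅ f vs ⁆ ∪ (⁅ f va ⁆ ∪ (⁅ f vb ⁆ ∪ (⁅ f vb' ⁆ ∪ (⁅ f va' ⁆ ∪ q))))))
    (sym (∪-identityʳ ⁅ f vt ⁆))

  inS : JV → Bool
  inS w = lookup S (f w)

  inS-covers : CoversJ inS
  inS-covers e = Equivalence.from T-∨ (map⊎ ∈⇒T ∈⇒T (proj₁ minimum _ _ (ContainsJ.edges J e)))

  -- Injectivity of f makes |S_i| the number of inner vertices labelled by inS.
  ∣innerPart∣≡innerCount : ∣ innerPart f S ∣ ≡ innerCount inS
  ∣innerPart∣≡innerCount =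
    trans (cong ∣_∣ innerPart≡S∩U) (∣p∩image∣ f (ContainsJ.injective J) innerL-unique S)

  outer∉U : ∀ w → ¬ Inner w → f w ∉ U
  outer∉U w outer fw∈U with ∈-image⁻ f innerL fw∈U
  ... | v , v∈ , fv≡fw = outer (subst Inner (ContainsJ.injective J fv≡fw) (All.lookup innerL-inner v∈))

  exchange-bound : (C : JV → Bool) → CoversJ C →
    (T (C vx) → f vx ∈ S) → (T (C vx') → f vx' ∈ S) →
    ∣ innerPart f S ∣ ≤ length (filter (T? ∘ C) innerL)
  exchange-bound C covers x-in-S x'-in-S = begin
    ∣ innerPart f S ∣  ≡⟨ cong ∣_∣ innerPart≡S∩U ⟩
    ∣ S ∩ U ∣          ≤⟨ exchange H minimum U R exchanged-covers ⟩
    ∣ R ∣              ≤⟨ ∣image∣≤length f (filter (T? ∘ C) innerL) ⟩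
    length (filter (T? ∘ C) innerL) ∎
    where
    open ≤-Reasoning
    R exchanged : Subset n
    R = image f (filter (T? ∘ C) innerL)
    exchanged = R ∪ (S ─ U)

    kept : ∀ {i} → i ∉ U → i ∈ S → i ∈ exchanged
    kept i∉U i∈S = x∈p∪q⁺ (inj₂ (x∈p∧x∉q⇒x∈p─q i∈S i∉U))

    labelled-in : ∀ w → T (C w) → f w ∈ exchanged
    labelled-in w c with listed-or-outer w
    ... | inj₁ w∈        = x∈p∪q⁺ (inj₁ (∈-image⁺ f (∈-filter⁺ (T? ∘ C) w∈ c)))
    ... | inj₂ (inj₁ refl) = kept (outer∉U vx (λ ())) (x-in-S c)
    ... | inj₂ (inj₂ refl) = kept (outer∉U vx' (λ ())) (x'-in-S c)

    -- An edge of H at a vertex of U is an edge of J, hence covered through C.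
    edge-at-U : ∀ {u v} → u ∈ U → Adj H u v → u ∈ exchanged ⊎ v ∈ exchanged
    edge-at-U u∈U uv with ∈-image⁻ f innerL u∈U
    ... | w , w∈ , refl with ContainsJ.closed J w (All.lookup innerL-inner w∈) _ uv
    ...   | w' , inj₁ e , refl = map⊎ (labelled-in w) (labelled-in w') (Equivalence.to T-∨ (covers e))
    ...   | w' , inj₂ e , refl = swap⊎ (map⊎ (labelled-in w') (labelled-in w) (Equivalence.to T-∨ (covers e)))

    exchanged-covers : IsVertexCover H exchanged
    exchanged-covers u v uv with u ∈? U | v ∈? U
    ... | yes u∈U | _       = edge-at-U u∈U uv
    ... | no _    | yes v∈U = swap⊎ (edge-at-U v∈U (Graph.sym H uv))
    ... | no u∉U  | no v∉U  = map⊎ (kept u∉U) (kept v∉U) (proj₁ minimum u v uv)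

mainTheorem4 : ∀ {n} (H : Graph n) (f : JV → Fin n) → ContainsJ H f →
    (S : Subset n) → IsMinVertexCover H S →
    ((f vx ∈ S ⊎ f vx' ∈ S) → ∣ innerPart f S ∣ ≡ 4) ×
    (¬ (f vx ∈ S ⊎ f vx' ∈ S) → ∣ innerPart f S ∣ ≡ 5)
mainTheorem4 H f J S minimum = some-outer , no-outer
  where
  open Gadget H f J S minimum

  at-least : ∀ {k} → k ≤ innerCount inS → k ≤ ∣ innerPart f S ∣
  at-least = subst (_ ≤_) (sym ∣innerPart∣≡innerCount)

  some-outer : (f vx ∈ S ⊎ f vx' ∈ S) → ∣ innerPart f S ∣ ≡ 4
  some-outer (inj₁ x∈S)  = ≤-antisym (exchange-bound cover-x cover-x-covers (λ _ → x∈S) (λ ()))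
                                     (at-least (four-inner inS inS-covers))
  some-outer (inj₂ x'∈S) = ≤-antisym (exchange-bound cover-x' cover-x'-covers (λ ()) (λ _ → x'∈S))
                                     (at-least (four-inner inS inS-covers))

  no-outer : ¬ (f vx ∈ S ⊎ f vx' ∈ S) → ∣ innerPart f S ∣ ≡ 5
  no-outer none = ≤-antisym (exchange-bound cover-none cover-none-covers (λ ()) (λ ()))
    (at-least (five-inner inS inS-covers (none ∘ inj₁ ∘ T⇒∈ S (f vx)) (none ∘ inj₂ ∘ T⇒∈ S (f vx'))))
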